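{- Let $G=(V,E)$ be a graph with maximum degree $d$, let $C\subseteq V$, $v\in C$, and $t\in\mathbb{N}$. Let $\eta$ be the probability that a $t$-step lazy random walk from $v$ in $G$ leaves $C$. Then for any $\sigma>\eta$, $\|\mathrm{clip}(\boldsymbol{p}_{v,t},\sigma-\eta)\|_2^2\ge\|\mathrm{clip}(\hat{\boldsymbol{p}}_{v,t},\sigma)\|_2^2$.
   Context: Lazy random walk on $G$: from $u$ (of degree $d_u$), move to each neighbor with probability $1/(2d)$ and stay at $u$ with probability $1-d_u/(2d)$. $\boldsymbol{p}_{v,t}\in\mathbb{R}^V$ is the endpoint distribution of a $t$-step lazy walk from $v$ in $G$. The walk restricted to $C$ is the Markov chain on $C$ obtained by deleting every edge $(u,w)$ with $u\in C$, $w\notin C$ and replacing it by an additional self-loop at $u$ of probability $1/(2d)$; $\hat{\boldsymbol{p}}_{v,t}\in\mathbb{R}^C$ is the endpoint distribution of the $t$-step walk from $v$ in this restricted chain. For a nonnegative vector $\boldsymbol{x}$ indexed by a finite set $U$ and $\xi\in[0,1)$, $\mathrm{clip}(\boldsymbol{x},\xi)$ is the lexicographically least vector $\boldsymbol{y}$ minimizing $\|\boldsymbol{y}\|_2$ subject to $\|\boldsymbol{x}-\boldsymbol{y}\|_1\le\xi$ and $\boldsymbol{y}(u)\le\boldsymbol{x}(u)$ for all $u\in U$.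
   Formalization: The parameter σ ranges over the rationals rather than the reals, and each clip is taken among vectors with rational entries. -}

module Defs where

open import Data.Nat as ℕ using (ℕ; zero; suc)
open import Data.Integer using (+_)
open import Data.Fin using (Fin; zero; suc; _<_)
open import Data.Bool using (Bool; true; false; if_then_else_; not; T)
open import Data.Product using (Σ; _×_; ∃)
open import Relation.Binary.PropositionalEquality using (_≡_)
open import Relation.Nullary using (¬_; does)
open import Data.Fin using (_≟_)
open import Data.Rational using (ℚ; 0ℚ; 1ℚ; _+_; _*_; _-_; ∣_∣; _/_; _≤_) renaming (_<_ to _<ℚ_)

sumFin : ∀ {n} → (Fin n → ℚ) → ℚ
sumFin {zero}  f = 0ℚ
sumFin {suc n} f = f zero + sumFin (λ i → f (suc i))

countFin : ∀ {n} → (Fin n → Bool) → ℕ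
countFin {zero}  p = 0
countFin {suc n} p = (if p zero then 1 else 0) ℕ.+ countFin (λ i → p (suc i))

[_] : Bool → ℚ
[ b ] = if b then 1ℚ else 0ℚ

ℕ→ℚ : ℕ → ℚ
ℕ→ℚ k = + k / 1

record Graph (n : ℕ) : Set where
  field
    adj     : Fin n → Fin n → Bool
    symm    : ∀ u w → adj u w ≡ adj w u
    irrefl  : ∀ u → adj u u ≡ false
open Graph public

deg : ∀ {n} → Graph n → Fin n → ℕ
deg G u = countFin (adj G u)

MaxDegree : ∀ {n} → Graph n → ℕ → Set
MaxDegree G d = (∀ u → deg G u ℕ.≤ d) × (∃ λ u → deg G u ≡ d)

-- 1/(2d)  (d = 0 only happens for edgeless graphs, where it is never used)
inv2d : ℕ → ℚ
inv2d zero    = 0ℚ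
inv2d (suc k) = + 1 / (2 ℕ.* suc k)

Subset : ℕ → Set
Subset n = Fin n → Bool

-- Lazy random walk on G:  P(u,w) = 1/(2d) if u~w, P(u,u) = 1 - d_u/(2d)

lazyP : ∀ {n} → Graph n → ℕ → Fin n → Fin n → ℚ
lazyP G d u w =
  if does (u ≟ w) then 1ℚ - ℕ→ℚ (deg G u) * inv2d d
  else [ adj G u w ] * inv2d d

-- p_{v,t}(w) : endpoint distribution of the t-step lazy walk from v
walkDist : ∀ {n} → Graph n → ℕ → Fin n → ℕ → Fin n → ℚ
walkDist G d v zero    w = [ does (v ≟ w) ]
walkDist G d v (suc t) w = sumFin (λ u → walkDist G d v t u * lazyP G d u w)

-- Walk restricted to C: edges leaving C become extra self-loops of weight 1/(2d)
restrictedP : ∀ {n} → Graph n → ℕ → Subset n → Fin n → Fin n → ℚ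
restrictedP G d C u w =
  if does (u ≟ w)
  then lazyP G d u u + ℕ→ℚ (countFin (λ x → adj G u x Data.Bool.∧ not (C x))) * inv2d d
  else lazyP G d u w

-- \hat p_{v,t}(w) for w ∈ C (a vector indexed by C; its values outside C are set to 0
-- and are irrelevant)
restrictedDist : ∀ {n} → Graph n → ℕ → Subset n → Fin n → ℕ → Fin n → ℚ
restrictedDist G d C v zero    w = [ C w Data.Bool.∧ does (v ≟ w) ]
restrictedDist G d C v (suc t) w =
  [ C w ] * sumFin (λ u → [ C u ] * restrictedDist G d C v t u * restrictedP G d C u w)

-- Probability that a t-step lazy walk from u in G leaves C (visits a vertex outside C
-- at some time 0..t); first-step decomposition.
leaveProb : ∀ {n} → Graph n → ℕ → Subset n → ℕ → Fin n → ℚ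
leaveProb G d C zero    u = [ not (C u) ]
leaveProb G d C (suc t) u =
  if C u then sumFin (λ w → lazyP G d u w * leaveProb G d C t w) else 1ℚ

-- Vectors indexed by a finite set U ⊆ Fin n (given by a Boolean predicate U);
-- only the entries at u ∈ U are meaningful.

Vect : ℕ → Set
Vect n = Fin n → ℚ

norm1 : ∀ {n} → Subset n → Vect n → ℚ
norm1 U x = sumFin (λ u → [ U u ] * ∣ x u ∣)

normSq : ∀ {n} → Subset n → Vect n → ℚ
normSq U x = sumFin (λ u → [ U u ] * (x u * x u))

Feasible : ∀ {n} → Subset n → Vect n → ℚ → Vect n → Set
Feasible U x ξ y = (norm1 U (λ u → x u - y u) ≤ ξ) × (∀ u → T (U u) → y u ≤ x u)

LexLess : ∀ {n} → Subset n → Vect n → Vect n → Set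
LexLess U y z = ∃ λ k → T (U k) × (y k <ℚ z k) × (∀ j → T (U j) → j < k → y j ≡ z j)

MinimizesNorm : ∀ {n} → Subset n → Vect n → ℚ → Vect n → Set
MinimizesNorm U x ξ y = Feasible U x ξ y × (∀ z → Feasible U x ξ z → normSq U y ≤ normSq U z)

-- y = clip(x, ξ): the lexicographically least minimizer of ‖y‖₂
IsClip : ∀ {n} → Subset n → Vect n → ℚ → Vect n → Set
IsClip U x ξ y = MinimizesNorm U x ξ y × (∀ z → MinimizesNorm U x ξ z → ¬ LexLess U z y)

all : ∀ {n} → Subset n
all _ = true

-- Let q be the distribution of the t-step lazy walk from v that is killed on
-- leaving C. It is dominated pointwise both by p = p_{v,t} and by p̂ = p̂_{v,t},
-- since the restricted chain only adds weight to self-loops; its mass is the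
-- probability 1 − η of staying in C, whereas p̂ has mass 1, so ‖p̂ − q‖₁ = η.
-- If y = clip(p, σ − η), then z = y ⊓ p̂ satisfies z ≤ p̂ and
-- ‖p̂ − z‖₁ ≤ ‖p̂ − q‖₁ + ‖p − y‖₁ ≤ σ, so z is feasible for clip(p̂, σ); and
-- z² ≤ y² pointwise because p̂ ≥ 0. Hence ‖clip(p̂, σ)‖₂² ≤ ‖z‖₂² ≤ ‖y‖₂².

{-# OPTIONS --safe #-}
module Submission where

open import Defs
open import Data.Nat using (ℕ)
open import Data.Fin using (Fin)
open import Data.Bool using (T)
open import Data.Rational using (ℚ; _-_; _≤_; _<_)

open import Data.Nat as ℕ using (zero; suc)
import Data.Nat.Properties as ℕ
import Data.Integer as ℤ
import Data.Integer.Properties as ℤ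
import Data.Nat.Coprimality as Coprime
open import Data.Fin using (zero; suc; _≟_)
open import Data.Bool using (Bool; true; false; _∧_; not; if_then_else_)
open import Data.Bool.Properties using (T-≡)
open import Function.Bundles using (Equivalence)
open import Data.Product using (_,_)
open import Data.Sum using (_⊎_; inj₁; inj₂)
open import Relation.Nullary using (Dec; does; yes; no)
open import Relation.Binary.PropositionalEquality
  using (_≡_; refl; sym; trans; cong; cong₂; subst; module ≡-Reasoning)
open import Data.Rational
  using (0ℚ; 1ℚ; _+_; _*_; -_; ∣_∣; _⊓_; mkℚ; nonNegative; nonPositive)
open import Data.Rational.Properties hiding (_≟_)
open import Data.Rational.Solver using (module +-*-Solver)
open +-*-Solver using (solve; _:+_; _:-_; _:*_; _:=_; con)
open import Algebra.Bundles using (CommutativeRing; CommutativeMonoid)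
open import Algebra.Properties.CommutativeSemigroup
  (CommutativeMonoid.commutativeSemigroup *-1-commutativeMonoid)
  using (x∙yz≈y∙xz; x∙yz≈yx∙z; xy∙z≈y∙xz)
open import Algebra.Properties.AbelianGroup +-0-abelianGroup using (xyx⁻¹≈y)
open import Algebra.Properties.Ring +-*-ring using (-1*x≈-x)
open import Algebra.Properties.Semiring.Sum (CommutativeRing.semiring +-*-commutativeRing)
  using (sum; sum-cong-≗; sum-replicate-zero; ∑-distrib-+; ∑-comm; *-distribˡ-sum; *-distribʳ-sum)

private
  variable
    n : ℕ

p≤q⇒0≤q-p : ∀ {p q} → p ≤ q → 0ℚ ≤ q - p
p≤q⇒0≤q-p {p} {q} p≤q = subst (_≤ q - p) (+-inverseʳ p) (+-monoˡ-≤ (- p) p≤q)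

p≤p+q : ∀ {p q} → 0ℚ ≤ q → p ≤ p + q
p≤p+q {p} {q} 0≤q = subst (_≤ p + q) (+-identityʳ p) (+-monoʳ-≤ p 0≤q)

0≤p⇒0≤q⇒0≤p*q : ∀ {p q} → 0ℚ ≤ p → 0ℚ ≤ q → 0ℚ ≤ p * q
0≤p⇒0≤q⇒0≤p*q {p} {q} 0≤p 0≤q =
  nonNegative⁻¹ (p * q) {{nonNeg*nonNeg⇒nonNeg p {{nonNegative 0≤p}} q {{nonNegative 0≤q}}}}

0≤p*p : ∀ p → 0ℚ ≤ p * p
0≤p*p p = subst (_≤ p * p) (*-zeroˡ p) (0*p≤p*p (≤-total 0ℚ p))
  where
  0*p≤p*p : 0ℚ ≤ p ⊎ p ≤ 0ℚ → 0ℚ * p ≤ p * p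
  0*p≤p*p (inj₁ 0≤p) = *-monoʳ-≤-nonNeg p {{nonNegative 0≤p}} 0≤p
  0*p≤p*p (inj₂ p≤0) = *-monoʳ-≤-nonPos p {{nonPositive p≤0}} p≤0

ℕ→ℚ≡mkℚ : ∀ k → ℕ→ℚ k ≡ mkℚ (ℤ.+ k) 0 (Coprime.sym (Coprime.1-coprimeTo k))
ℕ→ℚ≡mkℚ k = normalize-coprime (Coprime.sym (Coprime.1-coprimeTo k))

ℕ→ℚ-suc : ∀ k → ℕ→ℚ (suc k) ≡ 1ℚ + ℕ→ℚ k
ℕ→ℚ-suc k rewrite ℕ→ℚ≡mkℚ k =
  /-cong {p₁ = ℤ.+ suc k} {q₁ = 1} (cong (ℤ._+_ (ℤ.+ 1)) (sym (ℤ.*-identityʳ (ℤ.+ k)))) refl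

ℕ→ℚ-+ : ∀ a b → ℕ→ℚ (a ℕ.+ b) ≡ ℕ→ℚ a + ℕ→ℚ b
ℕ→ℚ-+ zero    b = sym (+-identityˡ (ℕ→ℚ b))
ℕ→ℚ-+ (suc a) b = begin
  ℕ→ℚ (suc (a ℕ.+ b))          ≡⟨ ℕ→ℚ-suc (a ℕ.+ b) ⟩
  1ℚ + ℕ→ℚ (a ℕ.+ b)           ≡⟨ cong (1ℚ +_) (ℕ→ℚ-+ a b) ⟩
  1ℚ + (ℕ→ℚ a + ℕ→ℚ b)         ≡⟨ +-assoc 1ℚ (ℕ→ℚ a) (ℕ→ℚ b) ⟨
  (1ℚ + ℕ→ℚ a) + ℕ→ℚ b         ≡⟨ cong (_+ ℕ→ℚ b) (ℕ→ℚ-suc a) ⟨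
  ℕ→ℚ (suc a) + ℕ→ℚ b          ∎
  where open ≡-Reasoning

0≤ℕ→ℚ : ∀ k → 0ℚ ≤ ℕ→ℚ k
0≤ℕ→ℚ k = nonNegative⁻¹ (ℕ→ℚ k) {{normalize-nonNeg k 1}}

ℕ→ℚ-mono-≤ : ∀ {a b} → a ℕ.≤ b → ℕ→ℚ a ≤ ℕ→ℚ b
ℕ→ℚ-mono-≤ {a} {b} a≤b = begin
  ℕ→ℚ a                        ≤⟨ p≤p+q (0≤ℕ→ℚ (b ℕ.∸ a)) ⟩
  ℕ→ℚ a + ℕ→ℚ (b ℕ.∸ a)        ≡⟨ ℕ→ℚ-+ a (b ℕ.∸ a) ⟨
  ℕ→ℚ (a ℕ.+ (b ℕ.∸ a))        ≡⟨ cong ℕ→ℚ (ℕ.m+[n∸m]≡n a≤b) ⟩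
  ℕ→ℚ b                        ∎
  where open ≤-Reasoning

ℕ→ℚ[2d]*inv2d≡1 : ∀ k → ℕ→ℚ (2 ℕ.* suc k) * inv2d (suc k) ≡ 1ℚ
ℕ→ℚ[2d]*inv2d≡1 k
  -- both factors are already in lowest terms, so normalisation leaves their mkℚ forms
  rewrite ℕ→ℚ≡mkℚ (2 ℕ.* suc k)
        | normalize-coprime {1} {k ℕ.+ suc (k ℕ.+ 0)} (Coprime.1-coprimeTo (2 ℕ.* suc k)) =
  *-inverseʳ (mkℚ (ℤ.+ (2 ℕ.* suc k)) 0 (Coprime.sym (Coprime.1-coprimeTo (2 ℕ.* suc k))))

0≤inv2d : ∀ d → 0ℚ ≤ inv2d d
0≤inv2d zero    = ≤-refl
0≤inv2d (suc k) = nonNegative⁻¹ (inv2d (suc k)) {{normalize-nonNeg 1 (2 ℕ.* suc k)}}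

0≤1-m*inv2d : ∀ {m d} → m ℕ.≤ d → 0ℚ ≤ 1ℚ - ℕ→ℚ m * inv2d d
0≤1-m*inv2d {m} {zero}  _   rewrite *-zeroʳ (ℕ→ℚ m) = nonNegative⁻¹ 1ℚ
0≤1-m*inv2d {m} {suc k} m≤d = p≤q⇒0≤q-p (begin
  ℕ→ℚ m * inv2d (suc k)            ≤⟨ *-monoʳ-≤-nonNeg (inv2d (suc k)) {{nonNegative (0≤inv2d (suc k))}}
                                        (ℕ→ℚ-mono-≤ (ℕ.≤-trans m≤d (ℕ.m≤m+n (suc k) _))) ⟩
  ℕ→ℚ (2 ℕ.* suc k) * inv2d (suc k) ≡⟨ ℕ→ℚ[2d]*inv2d≡1 k ⟩
  1ℚ                                 ∎)
  where open ≤-Reasoning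

0≤[b] : ∀ b → 0ℚ ≤ [ b ]
0≤[b] true  = nonNegative⁻¹ 1ℚ
0≤[b] false = ≤-refl

[b]*p≤p : ∀ {p} b → 0ℚ ≤ p → [ b ] * p ≤ p
[b]*p≤p {p} true  _   = ≤-reflexive (*-identityˡ p)
[b]*p≤p {p} false 0≤p = subst (_≤ p) (sym (*-zeroˡ p)) 0≤p

[b∧c]≡[b]*[c] : ∀ b c → [ b ∧ c ] ≡ [ b ] * [ c ]
[b∧c]≡[b]*[c] true  c = sym (*-identityˡ [ c ])
[b∧c]≡[b]*[c] false c = sym (*-zeroˡ [ c ])

[b]+[not-b]≡1 : ∀ b → [ b ] + [ not b ] ≡ 1ℚ
[b]+[not-b]≡1 true  = +-identityʳ 1ℚ
[b]+[not-b]≡1 false = +-identityˡ 1ℚ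

[false]*p≡0 : ∀ {b p} → b ≡ false → [ b ] * p ≡ 0ℚ
[false]*p≡0 {p = p} refl = *-zeroˡ p

T⇒[b]≡1 : ∀ {b} → T b → [ b ] ≡ 1ℚ
T⇒[b]≡1 b = cong [_] (Equivalence.to T-≡ b)

[b∧c]≤[c] : ∀ b c → [ b ∧ c ] ≤ [ c ]
[b∧c]≤[c] true  c = ≤-refl
[b∧c]≤[c] false c = 0≤[b] c

sumFin≡sum : (f : Fin n → ℚ) → sumFin f ≡ sum f
sumFin≡sum {zero}  f = refl
sumFin≡sum {suc n} f = cong (f zero +_) (sumFin≡sum (λ i → f (suc i)))

sumFin-cong : {f g : Fin n → ℚ} → (∀ i → f i ≡ g i) → sumFin f ≡ sumFin g
sumFin-cong {f = f} {g} f≗g =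
  trans (sumFin≡sum f) (trans (sum-cong-≗ {_} {f} {g} f≗g) (sym (sumFin≡sum g)))

sumFin-zero : ∀ n → sumFin {n} (λ _ → 0ℚ) ≡ 0ℚ
sumFin-zero n = trans (sumFin≡sum {n} (λ _ → 0ℚ)) (sum-replicate-zero n)

sumFin-+ : (f g : Fin n → ℚ) → sumFin (λ i → f i + g i) ≡ sumFin f + sumFin g
sumFin-+ f g = begin
  sumFin (λ i → f i + g i) ≡⟨ sumFin≡sum (λ i → f i + g i) ⟩
  sum (λ i → f i + g i)    ≡⟨ ∑-distrib-+ f g ⟩
  sum f + sum g            ≡⟨ cong₂ _+_ (sumFin≡sum f) (sumFin≡sum g) ⟨
  sumFin f + sumFin g      ∎
  where open ≡-Reasoning

*-distribˡ-sumFin : ∀ p (f : Fin n → ℚ) → p * sumFin f ≡ sumFin (λ i → p * f i)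
*-distribˡ-sumFin p f = begin
  p * sumFin f             ≡⟨ cong (p *_) (sumFin≡sum f) ⟩
  p * sum f                ≡⟨ *-distribˡ-sum p f ⟩
  sum (λ i → p * f i)      ≡⟨ sumFin≡sum (λ i → p * f i) ⟨
  sumFin (λ i → p * f i)   ∎
  where open ≡-Reasoning

*-distribʳ-sumFin : ∀ p (f : Fin n → ℚ) → sumFin f * p ≡ sumFin (λ i → f i * p)
*-distribʳ-sumFin p f = begin
  sumFin f * p             ≡⟨ cong (_* p) (sumFin≡sum f) ⟩
  sum f * p                ≡⟨ *-distribʳ-sum p f ⟩
  sum (λ i → f i * p)      ≡⟨ sumFin≡sum (λ i → f i * p) ⟨
  sumFin (λ i → f i * p)   ∎
  where open ≡-Reasoning

sumFin-comm : ∀ {m} (f : Fin n → Fin m → ℚ) →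
  sumFin (λ i → sumFin (f i)) ≡ sumFin (λ j → sumFin (λ i → f i j))
sumFin-comm f = begin
  sumFin (λ i → sumFin (f i))            ≡⟨ sumFin-cong (λ i → sumFin≡sum (f i)) ⟩
  sumFin (λ i → sum (f i))               ≡⟨ sumFin≡sum (λ i → sum (f i)) ⟩
  sum (λ i → sum (f i))                  ≡⟨ ∑-comm f ⟩
  sum (λ j → sum (λ i → f i j))          ≡⟨ sumFin≡sum (λ j → sum (λ i → f i j)) ⟨
  sumFin (λ j → sum (λ i → f i j))       ≡⟨ sumFin-cong (λ j → sumFin≡sum (λ i → f i j)) ⟨
  sumFin (λ j → sumFin (λ i → f i j))    ∎
  where open ≡-Reasoning

sumFin-neg : (f : Fin n → ℚ) → sumFin (λ i → - f i) ≡ - sumFin f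
sumFin-neg f = begin
  sumFin (λ i → - f i)        ≡⟨ sumFin-cong (λ i → -1*x≈-x (f i)) ⟨
  sumFin (λ i → - 1ℚ * f i)   ≡⟨ *-distribˡ-sumFin (- 1ℚ) f ⟨
  - 1ℚ * sumFin f             ≡⟨ -1*x≈-x (sumFin f) ⟩
  - sumFin f                  ∎
  where open ≡-Reasoning

sumFin-mono-≤ : {f g : Fin n → ℚ} → (∀ i → f i ≤ g i) → sumFin f ≤ sumFin g
sumFin-mono-≤ {zero}  f≤g = ≤-refl
sumFin-mono-≤ {suc n} f≤g = +-mono-≤ (f≤g zero) (sumFin-mono-≤ (λ i → f≤g (suc i)))

0≤sumFin : {f : Fin n → ℚ} → (∀ i → 0ℚ ≤ f i) → 0ℚ ≤ sumFin f
0≤sumFin {n} {f} 0≤f = subst (_≤ sumFin f) (sumFin-zero n) (sumFin-mono-≤ 0≤f)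

sumFin-[≟]* : (u : Fin n) (f : Fin n → ℚ) → sumFin (λ w → [ does (u ≟ w) ] * f w) ≡ f u
sumFin-[≟]* {suc n} zero f = begin
  1ℚ * f zero + sumFin (λ w → 0ℚ * f (suc w)) ≡⟨ cong₂ _+_ (*-identityˡ (f zero)) (sumFin-cong (λ w → *-zeroˡ (f (suc w)))) ⟩
  f zero + sumFin {n} (λ _ → 0ℚ)              ≡⟨ cong (f zero +_) (sumFin-zero n) ⟩
  f zero + 0ℚ                                 ≡⟨ +-identityʳ (f zero) ⟩
  f zero                                      ∎
  where open ≡-Reasoning
sumFin-[≟]* {suc n} (suc u) f =
  trans (cong₂ _+_ (*-zeroˡ (f zero)) (sumFin-[≟]* u (λ w → f (suc w)))) (+-identityˡ (f (suc u)))

sumFin-[b]*p≡count*p : (b : Fin n → Bool) (p : ℚ) → sumFin (λ w → [ b w ] * p) ≡ ℕ→ℚ (countFin b) * p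
sumFin-[b]*p≡count*p {zero}  b p = sym (*-zeroˡ p)
sumFin-[b]*p≡count*p {suc n} b p = countStep (b zero) (sumFin-[b]*p≡count*p (λ i → b (suc i)) p)
  where
  countStep : ∀ {S k} x → S ≡ ℕ→ℚ k * p → [ x ] * p + S ≡ ℕ→ℚ ((if x then 1 else 0) ℕ.+ k) * p
  countStep {S} {k} true  S≡kp = begin
    1ℚ * p + S            ≡⟨ cong (1ℚ * p +_) S≡kp ⟩
    1ℚ * p + ℕ→ℚ k * p    ≡⟨ *-distribʳ-+ p 1ℚ (ℕ→ℚ k) ⟨
    (1ℚ + ℕ→ℚ k) * p      ≡⟨ cong (_* p) (ℕ→ℚ-suc k) ⟨
    ℕ→ℚ (suc k) * p       ∎
    where open ≡-Reasoning
  countStep {S} false S≡kp = trans (cong (_+ S) (*-zeroˡ p)) (trans (+-identityˡ S) S≡kp)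

sumFin-partition : (b : Fin n → Bool) (f : Fin n → ℚ) →
  sumFin f ≡ sumFin (λ w → [ b w ] * f w) + sumFin (λ w → [ not (b w) ] * f w)
sumFin-partition b f =
  trans (sumFin-cong split) (sumFin-+ (λ w → [ b w ] * f w) (λ w → [ not (b w) ] * f w))
  where
  split : ∀ w → f w ≡ [ b w ] * f w + [ not (b w) ] * f w
  split w = begin
    f w                                  ≡⟨ *-identityˡ (f w) ⟨
    1ℚ * f w                             ≡⟨ cong (_* f w) ([b]+[not-b]≡1 (b w)) ⟨
    ([ b w ] + [ not (b w) ]) * f w      ≡⟨ *-distribʳ-+ (f w) [ b w ] [ not (b w) ] ⟩
    [ b w ] * f w + [ not (b w) ] * f w  ∎
    where open ≡-Reasoning

VanishesOutside : Subset n → (Fin n → ℚ) → Set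
VanishesOutside C f = ∀ w → C w ≡ false → f w ≡ 0ℚ

vanishesOutside⇒[C]*f≡f : ∀ {C : Subset n} {f} → VanishesOutside C f → ∀ w → [ C w ] * f w ≡ f w
vanishesOutside⇒[C]*f≡f {C = C} {f} f-vanishes w with C w in w∈?C
... | true  = *-identityˡ (f w)
... | false = trans (*-zeroˡ (f w)) (sym (f-vanishes w w∈?C))

module _ (G : Graph n) (d : ℕ) where

  selfLoopWeight : Fin n → ℚ
  selfLoopWeight u = 1ℚ - ℕ→ℚ (deg G u) * inv2d d

  lazyP-split : ∀ u w → lazyP G d u w ≡ [ does (u ≟ w) ] * selfLoopWeight u + [ adj G u w ] * inv2d d
  lazyP-split u w = split (u ≟ w)
    where
    split : (u≟w : Dec (u ≡ w)) →
      (if does u≟w then selfLoopWeight u else [ adj G u w ] * inv2d d)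
        ≡ [ does u≟w ] * selfLoopWeight u + [ adj G u w ] * inv2d d
    split (yes refl) rewrite irrefl G u =
      sym (trans (cong₂ _+_ (*-identityˡ (selfLoopWeight u)) (*-zeroˡ (inv2d d))) (+-identityʳ _))
    split (no _) = sym (trans (cong (_+ _) (*-zeroˡ (selfLoopWeight u))) (+-identityˡ _))

  lazyP-rowSum : ∀ u → sumFin (lazyP G d u) ≡ 1ℚ
  lazyP-rowSum u = begin
    sumFin (lazyP G d u)
      ≡⟨ sumFin-cong (lazyP-split u) ⟩
    sumFin (λ w → [ does (u ≟ w) ] * selfLoopWeight u + [ adj G u w ] * inv2d d)
      ≡⟨ sumFin-+ (λ w → [ does (u ≟ w) ] * selfLoopWeight u) (λ w → [ adj G u w ] * inv2d d) ⟩
    sumFin (λ w → [ does (u ≟ w) ] * selfLoopWeight u) + sumFin (λ w → [ adj G u w ] * inv2d d)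
      ≡⟨ cong₂ _+_ (sumFin-[≟]* u (λ _ → selfLoopWeight u)) (sumFin-[b]*p≡count*p (adj G u) (inv2d d)) ⟩
    (1ℚ - ℕ→ℚ (deg G u) * inv2d d) + ℕ→ℚ (deg G u) * inv2d d
      ≡⟨ solve 2 (λ a x → (con 1ℚ :- a :* x) :+ a :* x := con 1ℚ) refl (ℕ→ℚ (deg G u)) (inv2d d) ⟩
    1ℚ ∎
    where open ≡-Reasoning

  lazyP-nonNeg : (∀ u → deg G u ℕ.≤ d) → ∀ u w → 0ℚ ≤ lazyP G d u w
  lazyP-nonNeg deg≤d u w = subst (0ℚ ≤_) (sym (lazyP-split u w))
    (+-mono-≤ (0≤p⇒0≤q⇒0≤p*q (0≤[b] (does (u ≟ w))) (0≤1-m*inv2d (deg≤d u)))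
              (0≤p⇒0≤q⇒0≤p*q (0≤[b] (adj G u w)) (0≤inv2d d)))

  module _ (C : Subset n) where

    exitWeight : Fin n → ℚ
    exitWeight u = ℕ→ℚ (countFin (λ x → adj G u x ∧ not (C x))) * inv2d d

    restrictedP-split : ∀ u w →
      restrictedP G d C u w ≡ lazyP G d u w + [ does (u ≟ w) ] * exitWeight u
    restrictedP-split u w = split (u ≟ w)
      where
      split : (u≟w : Dec (u ≡ w)) →
        (if does u≟w then lazyP G d u u + exitWeight u else lazyP G d u w)
          ≡ lazyP G d u w + [ does u≟w ] * exitWeight u
      split (yes refl) = cong (lazyP G d u u +_) (sym (*-identityˡ (exitWeight u)))
      split (no _)     = sym (trans (cong (lazyP G d u w +_) (*-zeroˡ (exitWeight u))) (+-identityʳ _))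

    0≤exitWeight : ∀ u → 0ℚ ≤ exitWeight u
    0≤exitWeight u = 0≤p⇒0≤q⇒0≤p*q (0≤ℕ→ℚ (countFin (λ x → adj G u x ∧ not (C x)))) (0≤inv2d d)

    lazyP≤restrictedP : ∀ u w → lazyP G d u w ≤ restrictedP G d C u w
    lazyP≤restrictedP u w = begin
      lazyP G d u w                                    ≤⟨ p≤p+q (0≤p⇒0≤q⇒0≤p*q (0≤[b] (does (u ≟ w))) (0≤exitWeight u)) ⟩
      lazyP G d u w + [ does (u ≟ w) ] * exitWeight u  ≡⟨ restrictedP-split u w ⟨
      restrictedP G d C u w                            ∎
      where open ≤-Reasoning

    lazyP-exit : ∀ u → T (C u) → sumFin (λ w → [ not (C w) ] * lazyP G d u w) ≡ exitWeight u
    lazyP-exit u u∈C = begin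
      sumFin (λ w → [ not (C w) ] * lazyP G d u w)
        ≡⟨ sumFin-cong (λ w → trans (cong ([ not (C w) ] *_) (lazyP-split u w)) (regroup w)) ⟩
      sumFin (λ w → [ does (u ≟ w) ] * ([ not (C w) ] * selfLoopWeight u) + [ adj G u w ∧ not (C w) ] * inv2d d)
        ≡⟨ sumFin-+ (λ w → [ does (u ≟ w) ] * ([ not (C w) ] * selfLoopWeight u))
                    (λ w → [ adj G u w ∧ not (C w) ] * inv2d d) ⟩
      sumFin (λ w → [ does (u ≟ w) ] * ([ not (C w) ] * selfLoopWeight u))
        + sumFin (λ w → [ adj G u w ∧ not (C w) ] * inv2d d)
        ≡⟨ cong₂ _+_ (sumFin-[≟]* u (λ w → [ not (C w) ] * selfLoopWeight u))
                     (sumFin-[b]*p≡count*p (λ w → adj G u w ∧ not (C w)) (inv2d d)) ⟩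
      [ not (C u) ] * selfLoopWeight u + exitWeight u
        ≡⟨ cong (λ b → [ not b ] * selfLoopWeight u + exitWeight u) (Equivalence.to T-≡ u∈C) ⟩
      0ℚ * selfLoopWeight u + exitWeight u
        ≡⟨ trans (cong (_+ exitWeight u) (*-zeroˡ (selfLoopWeight u))) (+-identityˡ (exitWeight u)) ⟩
      exitWeight u ∎
      where
      open ≡-Reasoning
      regroup : ∀ w → [ not (C w) ] * ([ does (u ≟ w) ] * selfLoopWeight u + [ adj G u w ] * inv2d d)
                    ≡ [ does (u ≟ w) ] * ([ not (C w) ] * selfLoopWeight u) + [ adj G u w ∧ not (C w) ] * inv2d d
      regroup w = trans
        (solve 5 (λ c e s a x → c :* (e :* s :+ a :* x) := e :* (c :* s) :+ (a :* c) :* x) refl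
          [ not (C w) ] [ does (u ≟ w) ] (selfLoopWeight u) [ adj G u w ] (inv2d d))
        (cong (λ a → [ does (u ≟ w) ] * ([ not (C w) ] * selfLoopWeight u) + a * inv2d d)
          (sym ([b∧c]≡[b]*[c] (adj G u w) (not (C w)))))

    restrictedP-rowSum : ∀ u → T (C u) → sumFin (λ w → [ C w ] * restrictedP G d C u w) ≡ 1ℚ
    restrictedP-rowSum u u∈C = begin
      sumFin (λ w → [ C w ] * restrictedP G d C u w)
        ≡⟨ sumFin-cong (λ w → trans (cong ([ C w ] *_) (restrictedP-split u w))
                                    (*-distribˡ-+ [ C w ] (lazyP G d u w) _)) ⟩
      sumFin (λ w → [ C w ] * lazyP G d u w + [ C w ] * ([ does (u ≟ w) ] * exitWeight u))
        ≡⟨ sumFin-+ (λ w → [ C w ] * lazyP G d u w) (λ w → [ C w ] * ([ does (u ≟ w) ] * exitWeight u)) ⟩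
      inC + sumFin (λ w → [ C w ] * ([ does (u ≟ w) ] * exitWeight u))
        ≡⟨ cong (inC +_) (sumFin-cong (λ w → x∙yz≈y∙xz [ C w ] [ does (u ≟ w) ] (exitWeight u))) ⟩
      inC + sumFin (λ w → [ does (u ≟ w) ] * ([ C w ] * exitWeight u))
        ≡⟨ cong (inC +_) (sumFin-[≟]* u (λ w → [ C w ] * exitWeight u)) ⟩
      inC + [ C u ] * exitWeight u
        ≡⟨ cong (λ c → inC + c * exitWeight u) (T⇒[b]≡1 u∈C) ⟩
      inC + 1ℚ * exitWeight u
        ≡⟨ cong (inC +_) (trans (*-identityˡ (exitWeight u)) (sym (lazyP-exit u u∈C))) ⟩
      inC + sumFin (λ w → [ not (C w) ] * lazyP G d u w)
        ≡⟨ sumFin-partition C (lazyP G d u) ⟨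
      sumFin (lazyP G d u)
        ≡⟨ lazyP-rowSum u ⟩
      1ℚ ∎
      where
      open ≡-Reasoning
      inC : ℚ
      inC = sumFin (λ w → [ C w ] * lazyP G d u w)

    stayProb : ℕ → Fin n → ℚ
    stayProb zero    u = [ C u ]
    stayProb (suc t) u = [ C u ] * sumFin (λ w → lazyP G d u w * stayProb t w)

    stayProb-vanishesOutside : ∀ t → VanishesOutside C (stayProb t)
    stayProb-vanishesOutside zero    w w∉C = cong [_] w∉C
    stayProb-vanishesOutside (suc t) w w∉C = [false]*p≡0 w∉C

    stayProb+leaveProb≡1 : ∀ t u → stayProb t u + leaveProb G d C t u ≡ 1ℚ
    stayProb+leaveProb≡1 zero    u = [b]+[not-b]≡1 (C u)
    stayProb+leaveProb≡1 (suc t) u = byMembership (C u) (begin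
      sumFin (λ w → lazyP G d u w * stayProb t w) + sumFin (λ w → lazyP G d u w * leaveProb G d C t w)
        ≡⟨ sumFin-+ (λ w → lazyP G d u w * stayProb t w) (λ w → lazyP G d u w * leaveProb G d C t w) ⟨
      sumFin (λ w → lazyP G d u w * stayProb t w + lazyP G d u w * leaveProb G d C t w)
        ≡⟨ sumFin-cong (λ w → *-distribˡ-+ (lazyP G d u w) (stayProb t w) (leaveProb G d C t w)) ⟨
      sumFin (λ w → lazyP G d u w * (stayProb t w + leaveProb G d C t w))
        ≡⟨ sumFin-cong (λ w → trans (cong (lazyP G d u w *_) (stayProb+leaveProb≡1 t w)) (*-identityʳ _)) ⟩
      sumFin (lazyP G d u)
        ≡⟨ lazyP-rowSum u ⟩
      1ℚ ∎)
      where
      open ≡-Reasoning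
      byMembership : ∀ {S L} b → S + L ≡ 1ℚ → [ b ] * S + (if b then L else 1ℚ) ≡ 1ℚ
      byMembership {S} {L} true  S+L≡1 = trans (cong (_+ L) (*-identityˡ S)) S+L≡1
      byMembership {S}     false _     = trans (cong (_+ 1ℚ) (*-zeroˡ S)) (+-identityˡ 1ℚ)

    -- The walk from v killed on leaving C

    module _ (v : Fin n) where

      killedDist : ℕ → Fin n → ℚ
      killedDist zero    w = [ C w ∧ does (v ≟ w) ]
      killedDist (suc t) w = [ C w ] * sumFin (λ u → killedDist t u * lazyP G d u w)

      killedDist-vanishesOutside : ∀ t → VanishesOutside C (killedDist t)
      killedDist-vanishesOutside zero    w w∉C = cong (λ b → [ b ∧ does (v ≟ w) ]) w∉C
      killedDist-vanishesOutside (suc t) w w∉C = [false]*p≡0 w∉C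

      restrictedDist-vanishesOutside : ∀ t → VanishesOutside C (restrictedDist G d C v t)
      restrictedDist-vanishesOutside zero    w w∉C = cong (λ b → [ b ∧ does (v ≟ w) ]) w∉C
      restrictedDist-vanishesOutside (suc t) w w∉C = [false]*p≡0 w∉C

      -- Generalised over m so that the forward recursion of killedDist can be
      -- traded, one step at a time, for the backward recursion of stayProb.
      killedDist-stayProb : ∀ t m → sumFin (λ w → killedDist t w * stayProb m w) ≡ stayProb (t ℕ.+ m) v
      killedDist-stayProb zero m = begin
        sumFin (λ w → [ C w ∧ does (v ≟ w) ] * stayProb m w)
          ≡⟨ sumFin-cong (λ w → cong (_* stayProb m w) ([b∧c]≡[b]*[c] (C w) (does (v ≟ w)))) ⟩
        sumFin (λ w → ([ C w ] * [ does (v ≟ w) ]) * stayProb m w)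
          ≡⟨ sumFin-cong (λ w → trans (xy∙z≈y∙xz [ C w ] [ does (v ≟ w) ] (stayProb m w))
               (cong ([ does (v ≟ w) ] *_) (vanishesOutside⇒[C]*f≡f (stayProb-vanishesOutside m) w))) ⟩
        sumFin (λ w → [ does (v ≟ w) ] * stayProb m w)
          ≡⟨ sumFin-[≟]* v (stayProb m) ⟩
        stayProb m v ∎
        where open ≡-Reasoning
      killedDist-stayProb (suc t) m = begin
        sumFin (λ w → ([ C w ] * inflow w) * stayProb m w)
          ≡⟨ sumFin-cong (λ w → trans (xy∙z≈y∙xz [ C w ] (inflow w) (stayProb m w))
               (cong (inflow w *_) (vanishesOutside⇒[C]*f≡f (stayProb-vanishesOutside m) w))) ⟩
        sumFin (λ w → inflow w * stayProb m w)
          ≡⟨ sumFin-cong (λ w → *-distribʳ-sumFin (stayProb m w) (λ u → q u * lazyP G d u w)) ⟩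
        sumFin (λ w → sumFin (λ u → (q u * lazyP G d u w) * stayProb m w))
          ≡⟨ sumFin-comm (λ w u → (q u * lazyP G d u w) * stayProb m w) ⟩
        sumFin (λ u → sumFin (λ w → (q u * lazyP G d u w) * stayProb m w))
          ≡⟨ sumFin-cong (λ u → trans (sumFin-cong (λ w → *-assoc (q u) (lazyP G d u w) (stayProb m w)))
               (sym (*-distribˡ-sumFin (q u) (λ w → lazyP G d u w * stayProb m w)))) ⟩
        sumFin (λ u → q u * stayNext u)
          ≡⟨ sumFin-cong (λ u → trans (x∙yz≈yx∙z (q u) [ C u ] (stayNext u))
               (cong (_* stayNext u) (vanishesOutside⇒[C]*f≡f (killedDist-vanishesOutside t) u))) ⟨
        sumFin (λ u → q u * stayProb (suc m) u)
          ≡⟨ killedDist-stayProb t (suc m) ⟩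
        stayProb (t ℕ.+ suc m) v
          ≡⟨ cong (λ k → stayProb k v) (ℕ.+-suc t m) ⟩
        stayProb (suc t ℕ.+ m) v ∎
        where
        open ≡-Reasoning
        q : Fin n → ℚ
        q = killedDist t
        inflow : Fin n → ℚ
        inflow w = sumFin (λ u → q u * lazyP G d u w)
        stayNext : Fin n → ℚ
        stayNext u = sumFin (λ w → lazyP G d u w * stayProb m w)

      killedDist-sum : ∀ t → sumFin (killedDist t) ≡ stayProb t v
      killedDist-sum t = begin
        sumFin (killedDist t)
          ≡⟨ sumFin-cong (λ w → trans (*-comm (killedDist t w) [ C w ])
               (vanishesOutside⇒[C]*f≡f (killedDist-vanishesOutside t) w)) ⟨
        sumFin (λ w → killedDist t w * stayProb 0 w)
          ≡⟨ killedDist-stayProb t 0 ⟩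
        stayProb (t ℕ.+ 0) v
          ≡⟨ cong (λ k → stayProb k v) (ℕ.+-identityʳ t) ⟩
        stayProb t v ∎
        where open ≡-Reasoning

      restrictedDist-sum : T (C v) → ∀ t → sumFin (restrictedDist G d C v t) ≡ 1ℚ
      restrictedDist-sum v∈C zero = begin
        sumFin (λ w → [ C w ∧ does (v ≟ w) ])
          ≡⟨ sumFin-cong (λ w → trans ([b∧c]≡[b]*[c] (C w) (does (v ≟ w))) (*-comm [ C w ] _)) ⟩
        sumFin (λ w → [ does (v ≟ w) ] * [ C w ])
          ≡⟨ sumFin-[≟]* v (λ w → [ C w ]) ⟩
        [ C v ]
          ≡⟨ T⇒[b]≡1 v∈C ⟩
        1ℚ ∎
        where open ≡-Reasoning
      restrictedDist-sum v∈C (suc t) = begin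
        sumFin (λ w → [ C w ] * sumFin (λ u → [ C u ] * p̂ u * restrictedP G d C u w))
          ≡⟨ sumFin-cong (λ w → cong ([ C w ] *_) (sumFin-cong (λ u →
               cong (_* restrictedP G d C u w) (vanishesOutside⇒[C]*f≡f (restrictedDist-vanishesOutside t) u)))) ⟩
        sumFin (λ w → [ C w ] * sumFin (λ u → p̂ u * restrictedP G d C u w))
          ≡⟨ sumFin-cong (λ w → *-distribˡ-sumFin [ C w ] (λ u → p̂ u * restrictedP G d C u w)) ⟩
        sumFin (λ w → sumFin (λ u → [ C w ] * (p̂ u * restrictedP G d C u w)))
          ≡⟨ sumFin-comm (λ w u → [ C w ] * (p̂ u * restrictedP G d C u w)) ⟩
        sumFin (λ u → sumFin (λ w → [ C w ] * (p̂ u * restrictedP G d C u w)))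
          ≡⟨ sumFin-cong (λ u → trans (sumFin-cong (λ w → x∙yz≈y∙xz [ C w ] (p̂ u) _))
               (sym (*-distribˡ-sumFin (p̂ u) (λ w → [ C w ] * restrictedP G d C u w)))) ⟩
        sumFin (λ u → p̂ u * sumFin (λ w → [ C w ] * restrictedP G d C u w))
          ≡⟨ sumFin-cong p̂*rowSum≡p̂ ⟩
        sumFin p̂
          ≡⟨ restrictedDist-sum v∈C t ⟩
        1ℚ ∎
        where
        open ≡-Reasoning
        p̂ : Fin n → ℚ
        p̂ = restrictedDist G d C v t
        rowSum : Fin n → ℚ
        rowSum u = sumFin (λ w → [ C w ] * restrictedP G d C u w)
        p̂*rowSum≡p̂ : ∀ u → p̂ u * rowSum u ≡ p̂ u
        p̂*rowSum≡p̂ u with C u in u∈?C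
        ... | true  = trans (cong (p̂ u *_) (restrictedP-rowSum u (Equivalence.from T-≡ u∈?C))) (*-identityʳ (p̂ u))
        ... | false = trans (cong (_* rowSum u) p̂u≡0) (trans (*-zeroˡ (rowSum u)) (sym p̂u≡0))
          where
          p̂u≡0 : p̂ u ≡ 0ℚ
          p̂u≡0 = restrictedDist-vanishesOutside t u u∈?C

      restrictedDist-killedDist-gap : T (C v) → ∀ t →
        sumFin (λ w → restrictedDist G d C v t w - killedDist t w) ≡ leaveProb G d C t v
      restrictedDist-killedDist-gap v∈C t = begin
        sumFin (λ w → restrictedDist G d C v t w - killedDist t w)
          ≡⟨ sumFin-+ (restrictedDist G d C v t) (λ w → - killedDist t w) ⟩
        sumFin (restrictedDist G d C v t) + sumFin (λ w → - killedDist t w)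
          ≡⟨ cong₂ _+_ (restrictedDist-sum v∈C t) (trans (sumFin-neg (killedDist t)) (cong -_ (killedDist-sum t))) ⟩
        1ℚ - stayProb t v
          ≡⟨ cong (_- stayProb t v) (stayProb+leaveProb≡1 t v) ⟨
        (stayProb t v + leaveProb G d C t v) - stayProb t v
          ≡⟨ xyx⁻¹≈y (stayProb t v) (leaveProb G d C t v) ⟩
        leaveProb G d C t v ∎
        where open ≡-Reasoning

      module _ (deg≤d : ∀ u → deg G u ℕ.≤ d) where

        restrictedP-nonNeg : ∀ u w → 0ℚ ≤ restrictedP G d C u w
        restrictedP-nonNeg u w = ≤-trans (lazyP-nonNeg deg≤d u w) (lazyP≤restrictedP u w)

        killedDist-nonNeg : ∀ t w → 0ℚ ≤ killedDist t w
        killedDist-nonNeg zero    w = 0≤[b] (C w ∧ does (v ≟ w))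
        killedDist-nonNeg (suc t) w = 0≤p⇒0≤q⇒0≤p*q (0≤[b] (C w))
          (0≤sumFin (λ u → 0≤p⇒0≤q⇒0≤p*q (killedDist-nonNeg t u) (lazyP-nonNeg deg≤d u w)))

        restrictedDist-nonNeg : ∀ t w → 0ℚ ≤ restrictedDist G d C v t w
        restrictedDist-nonNeg zero    w = 0≤[b] (C w ∧ does (v ≟ w))
        restrictedDist-nonNeg (suc t) w = 0≤p⇒0≤q⇒0≤p*q (0≤[b] (C w))
          (0≤sumFin (λ u → 0≤p⇒0≤q⇒0≤p*q (0≤p⇒0≤q⇒0≤p*q (0≤[b] (C u)) (restrictedDist-nonNeg t u))
                                          (restrictedP-nonNeg u w)))

        killedDist≤walkDist : ∀ t w → killedDist t w ≤ walkDist G d v t w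
        killedDist≤walkDist zero    w = [b∧c]≤[c] (C w) (does (v ≟ w))
        killedDist≤walkDist (suc t) w = ≤-trans
          ([b]*p≤p (C w) (0≤sumFin (λ u → 0≤p⇒0≤q⇒0≤p*q (killedDist-nonNeg t u) (lazyP-nonNeg deg≤d u w))))
          (sumFin-mono-≤ (λ u → *-monoʳ-≤-nonNeg (lazyP G d u w) {{nonNegative (lazyP-nonNeg deg≤d u w)}}
                                  (killedDist≤walkDist t u)))

        killedDist≤restrictedDist : ∀ t w → killedDist t w ≤ restrictedDist G d C v t w
        killedDist≤restrictedDist zero    w = ≤-refl
        killedDist≤restrictedDist (suc t) w =
          *-monoˡ-≤-nonNeg [ C w ] {{nonNegative (0≤[b] (C w))}} (sumFin-mono-≤ flow≤)
          where
          open ≤-Reasoning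
          p̂ : Fin n → ℚ
          p̂ = restrictedDist G d C v t
          flow≤ : ∀ u → killedDist t u * lazyP G d u w ≤ [ C u ] * p̂ u * restrictedP G d C u w
          flow≤ u = begin
            killedDist t u * lazyP G d u w
              ≤⟨ *-monoʳ-≤-nonNeg (lazyP G d u w) {{nonNegative (lazyP-nonNeg deg≤d u w)}}
                   (killedDist≤restrictedDist t u) ⟩
            p̂ u * lazyP G d u w
              ≤⟨ *-monoˡ-≤-nonNeg (p̂ u) {{nonNegative (restrictedDist-nonNeg t u)}} (lazyP≤restrictedP u w) ⟩
            p̂ u * restrictedP G d C u w
              ≡⟨ cong (_* restrictedP G d C u w) (vanishesOutside⇒[C]*f≡f (restrictedDist-vanishesOutside t) u) ⟨
            [ C u ] * p̂ u * restrictedP G d C u w ∎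

p-q⊓p≤[p-r]+[s-q] : ∀ {p q r s} → r ≤ p → r ≤ s → q ≤ s → p - q ⊓ p ≤ (p - r) + (s - q)
p-q⊓p≤[p-r]+[s-q] {p} {q} {r} {s} r≤p r≤s q≤s with ≤-total q p
... | inj₁ q≤p = begin
  p - q ⊓ p           ≡⟨ cong (_-_ p) (p≤q⇒p⊓q≡p q≤p) ⟩
  p - q               ≡⟨ solve 3 (λ p q r → p :- q := (p :- r) :+ (r :- q)) refl p q r ⟩
  (p - r) + (r - q)   ≤⟨ +-monoʳ-≤ (p - r) (+-monoˡ-≤ (- q) r≤s) ⟩
  (p - r) + (s - q)   ∎
  where open ≤-Reasoning
... | inj₂ p≤q = begin
  p - q ⊓ p           ≡⟨ cong (_-_ p) (p≥q⇒p⊓q≡q p≤q) ⟩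
  p - p               ≡⟨ +-inverseʳ p ⟩
  0ℚ                  ≤⟨ +-mono-≤ (p≤q⇒0≤q-p r≤p) (p≤q⇒0≤q-p q≤s) ⟩
  (p - r) + (s - q)   ∎
  where open ≤-Reasoning

p⊓q*p⊓q≤p*p : ∀ {p q} → 0ℚ ≤ q → (p ⊓ q) * (p ⊓ q) ≤ p * p
p⊓q*p⊓q≤p*p {p} {q} 0≤q with ≤-total p q
... | inj₁ p≤q rewrite p≤q⇒p⊓q≡p p≤q = ≤-refl
... | inj₂ q≤p rewrite p≥q⇒p⊓q≡q q≤p = begin
  q * q   ≤⟨ *-monoˡ-≤-nonNeg q {{nonNegative 0≤q}} q≤p ⟩
  q * p   ≤⟨ *-monoʳ-≤-nonNeg p {{nonNegative (≤-trans 0≤q q≤p)}} q≤p ⟩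
  p * p   ∎
  where open ≤-Reasoning

⊓-feasible : ∀ (U : Subset n) {x x̂ r y : Vect n} {ξ} →
  (∀ w → r w ≤ x w) → (∀ w → r w ≤ x̂ w) → Feasible all x ξ y →
  Feasible U x̂ (sumFin (λ w → x̂ w - r w) + ξ) (λ w → y w ⊓ x̂ w)
⊓-feasible U {x} {x̂} {r} {y} {ξ} r≤x r≤x̂ (‖x-y‖₁≤ξ , y≤x) = ‖x̂-y⊓x̂‖₁≤ , λ w _ → p⊓q≤q (y w) (x̂ w)
  where
  open ≤-Reasoning
  pointwise : ∀ w → [ U w ] * ∣ x̂ w - y w ⊓ x̂ w ∣ ≤ (x̂ w - r w) + 1ℚ * ∣ x w - y w ∣
  pointwise w = begin
    [ U w ] * ∣ x̂ w - y w ⊓ x̂ w ∣   ≤⟨ [b]*p≤p (U w) (0≤∣p∣ _) ⟩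
    ∣ x̂ w - y w ⊓ x̂ w ∣             ≡⟨ 0≤p⇒∣p∣≡p (p≤q⇒0≤q-p (p⊓q≤q (y w) (x̂ w))) ⟩
    x̂ w - y w ⊓ x̂ w                 ≤⟨ p-q⊓p≤[p-r]+[s-q] (r≤x̂ w) (r≤x w) y≤x[w] ⟩
    (x̂ w - r w) + (x w - y w)        ≡⟨ cong ((x̂ w - r w) +_)
                                            (trans (*-identityˡ ∣ x w - y w ∣) (0≤p⇒∣p∣≡p (p≤q⇒0≤q-p y≤x[w]))) ⟨
    (x̂ w - r w) + 1ℚ * ∣ x w - y w ∣ ∎
    where
    y≤x[w] : y w ≤ x w
    y≤x[w] = y≤x w _
  ‖x̂-y⊓x̂‖₁≤ : norm1 U (λ w → x̂ w - y w ⊓ x̂ w) ≤ sumFin (λ w → x̂ w - r w) + ξ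
  ‖x̂-y⊓x̂‖₁≤ = begin
    norm1 U (λ w → x̂ w - y w ⊓ x̂ w)
      ≤⟨ sumFin-mono-≤ pointwise ⟩
    sumFin (λ w → (x̂ w - r w) + 1ℚ * ∣ x w - y w ∣)
      ≡⟨ sumFin-+ (λ w → x̂ w - r w) (λ w → 1ℚ * ∣ x w - y w ∣) ⟩
    sumFin (λ w → x̂ w - r w) + norm1 all (λ w → x w - y w)
      ≤⟨ +-monoʳ-≤ (sumFin (λ w → x̂ w - r w)) ‖x-y‖₁≤ξ ⟩
    sumFin (λ w → x̂ w - r w) + ξ ∎

normSq-⊓ : ∀ (U : Subset n) (y a : Vect n) → (∀ w → 0ℚ ≤ a w) →
  normSq U (λ w → y w ⊓ a w) ≤ normSq all y
normSq-⊓ U y a 0≤a = sumFin-mono-≤ λ w → begin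
  [ U w ] * ((y w ⊓ a w) * (y w ⊓ a w))  ≤⟨ [b]*p≤p (U w) (0≤p*p (y w ⊓ a w)) ⟩
  (y w ⊓ a w) * (y w ⊓ a w)              ≤⟨ p⊓q*p⊓q≤p*p {y w} (0≤a w) ⟩
  y w * y w                              ≡⟨ *-identityˡ (y w * y w) ⟨
  1ℚ * (y w * y w)                       ∎
  where open ≤-Reasoning

claim3p4 : (n : ℕ) (G : Graph n) (d : ℕ) → MaxDegree G d →
           (C : Subset n) (v : Fin n) → T (C v) → (t : ℕ) →
           (σ : ℚ) → leaveProb G d C t v < σ →
           (y ŷ : Vect n) →
           IsClip all (walkDist G d v t) (σ - leaveProb G d C t v) y →
           IsClip C (restrictedDist G d C v t) σ ŷ →
           normSq C ŷ ≤ normSq all y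
claim3p4 n G d (deg≤d , _) C v v∈C t σ _ y ŷ ((y-feasible , _) , _) ((_ , ŷ-minimal) , _) = begin
  normSq C ŷ                        ≤⟨ ŷ-minimal (λ w → y w ⊓ p̂ w) z-feasible ⟩
  normSq C (λ w → y w ⊓ p̂ w)        ≤⟨ normSq-⊓ C y p̂ (restrictedDist-nonNeg G d C v deg≤d t) ⟩
  normSq all y                      ∎
  where
  open ≤-Reasoning
  p̂ q : Vect n
  p̂ = restrictedDist G d C v t
  q = killedDist G d C v t
  η : ℚ
  η = leaveProb G d C t v
  budget : sumFin (λ w → p̂ w - q w) + (σ - η) ≡ σ
  budget = trans (cong (_+ (σ - η)) (restrictedDist-killedDist-gap G d C v v∈C t))
                 (trans (sym (+-assoc η σ (- η))) (xyx⁻¹≈y η σ))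
  z-feasible : Feasible C p̂ σ (λ w → y w ⊓ p̂ w)
  z-feasible = subst (λ ξ → Feasible C p̂ ξ (λ w → y w ⊓ p̂ w)) budget
    (⊓-feasible C (killedDist≤walkDist G d C v deg≤d t) (killedDist≤restrictedDist G d C v deg≤d t) y-feasible)
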